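{- Let $f,g,h$ be monotone functions on binary relations over a set $X$ and let $m\ge1$ be an integer. Suppose $g\subseteq\mathrm{id}$, $f$ is $g$-compatible, $f$ is $(h\circ g^m),h$-compatible (i.e. $f\circ((h\circ g^m)\cap h)\subseteq h\circ f$), and $$\forall n\in\mathbb N,\quad f^n\circ\Big(\bigcup_{i\le mn+1}f^i\Big)\subseteq\bigcup_{i\in\mathbb N}f^i .$$ Then $f$ is $(g\cap h)$-sound via $f^\omega$: for every relation $\mathcal R$, $\mathcal R\subseteq(g\cap h)(f(\mathcal R))$ implies $f^\omega(\mathcal R)\subseteq(g\cap h)(f^\omega(\mathcal R))$ (and $f^\omega$ is extensive).
   Context: Fix a set $X$. A function on relations is a map from the set of binary relations on $X$ to itself. For such functions, $(f\circ g)(\mathcal R)=f(g(\mathcal R))$, intersections and (indexed) unions are pointwise, and $f\subseteq g$ means $f(\mathcal R)\subseteq g(\mathcal R)$ for all $\mathcal R$. $f^0=\mathrm{id}$, $f^{n+1}=f\circ f^n$, $f^\omega(\mathcal R)=\bigcup_{n\in\mathbb N}f^n(\mathcal R)$. $f$ is monotone if $\mathcal R\subseteq\mathcal S$ implies $f(\mathcal R)\subseteq f(\mathcal S)$; extensive if $\mathrm{id}\subseteq f$. $f$ is $g$-compatible if $f\circ g\subseteq g\circ f$; $f$ is $g,h$-compatible if $f\circ(g\cap h)\subseteq h\circ f$. $f$ is $g$-sound via $f'$ if $f'$ is extensive and for every $\mathcal R$, $\mathcal R\subseteq g(f(\mathcal R))$ implies $f'(\mathcal R)\subseteq g(f'(\mathcal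 R))$. -}

module Defs where

open import Level using (Level; _⊔_) renaming (suc to lsuc)
open import Data.Nat using (ℕ; zero; suc; _≤_)
open import Data.Product using (Σ; _×_; _,_)
open import Relation.Binary.Core using (Rel; _⇒_)

-- Binary relations on X are Rel X ℓ (proof-relevant predicates X → X → Set ℓ);
-- inclusion R ⊆ S is the stdlib  R ⇒ S  (∀ {x y} → R x y → S x y).

RFun : ∀ {a} (X : Set a) (ℓ : Level) → Set (a ⊔ lsuc ℓ)
RFun X ℓ = Rel X ℓ → Rel X ℓ

module _ {a ℓ : Level} {X : Set a} where

  idᶠ : RFun X ℓ
  idᶠ R = R

  _∘ᶠ_ : RFun X ℓ → RFun X ℓ → RFun X ℓ
  (f ∘ᶠ g) R = f (g R)

  _∩ᶠ_ : RFun X ℓ → RFun X ℓ → RFun X ℓ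
  (f ∩ᶠ g) R x y = f R x y × g R x y

  _⊆ᶠ_ : RFun X ℓ → RFun X ℓ → Set (a ⊔ lsuc ℓ)
  f ⊆ᶠ g = ∀ (R : Rel X ℓ) → f R ⇒ g R

  iter : RFun X ℓ → ℕ → RFun X ℓ
  iter f zero    = idᶠ
  iter f (suc n) = f ∘ᶠ iter f n

  omega : RFun X ℓ → RFun X ℓ
  omega f R x y = Σ ℕ λ n → iter f n R x y

  iterUpTo : RFun X ℓ → ℕ → RFun X ℓ
  iterUpTo f k R x y = Σ ℕ λ i → i ≤ k × iter f i R x y

  Monotone : RFun X ℓ → Set (a ⊔ lsuc ℓ)
  Monotone f = ∀ {R S : Rel X ℓ} → R ⇒ S → f R ⇒ f S

  Extensive : RFun X ℓ → Set (a ⊔ lsuc ℓ)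
  Extensive f = idᶠ ⊆ᶠ f

  Compatible : RFun X ℓ → RFun X ℓ → Set (a ⊔ lsuc ℓ)
  Compatible f g = (f ∘ᶠ g) ⊆ᶠ (g ∘ᶠ f)

  Compatible₂ : RFun X ℓ → RFun X ℓ → RFun X ℓ → Set (a ⊔ lsuc ℓ)
  Compatible₂ f g h = (f ∘ᶠ (g ∩ᶠ h)) ⊆ᶠ (h ∘ᶠ f)

  SoundVia : RFun X ℓ → RFun X ℓ → RFun X ℓ → Set (a ⊔ lsuc ℓ)
  SoundVia f g f' =
    Extensive f' ×
    (∀ (R : Rel X ℓ) → R ⇒ g (f R) → f' R ⇒ g (f' R))

{-# OPTIONS --safe #-}
module Submission where

-- Let R ⊆ g(fR) ∩ h(fR). The g-half is a compatibility argument: f^n R ⊆ f^n(g(fR)) ⊆ g(f^{n+1} R).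
-- The h-half is an invariant proved by induction on n: f^n R ⊆ h(f^n(U_n R)), where
-- U_n = ⋃_{i ≤ mn+1} f^i. For the step, iterating R ⊆ g(fR) gives U_n R ⊆ g^m(U_{n+1} R), so
-- f^n R lies in both h(g^m(f^n(U_{n+1} R))) and h(f^n(U_{n+1} R)), and (h ∘ g^m),h-compatibility
-- moves one more f inside h. The hypothesis on f^n ∘ U_n finally puts f^n(U_n R) inside f^ω R.

open import Defs
open import Level using (Level)
open import Data.Nat using (ℕ; zero; suc; _+_; _*_; _≤_; _≥_)
open import Data.Nat.Properties using (≤-trans; ≤-reflexive; +-suc; +-assoc; *-suc; +-monoʳ-≤; m≤n+m)
open import Data.Product using (_,_; proj₁; proj₂)
open import Relation.Binary.Core using (Rel; _⇒_)
open import Relation.Binary.PropositionalEquality using (_≡_; subst; trans; sym; cong)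

module _ {a ℓ : Level} {X : Set a} where

  iter-monotone : ∀ {f : RFun X ℓ} → Monotone f → ∀ n → Monotone (iter f n)
  iter-monotone monoF zero    R⇒S = R⇒S
  iter-monotone monoF (suc n) R⇒S = monoF (iter-monotone monoF n R⇒S)

  iterUpTo-monotone : ∀ {f : RFun X ℓ} {k l} → k ≤ l → iterUpTo f k ⊆ᶠ iterUpTo f l
  iterUpTo-monotone k≤l R (i , i≤k , p) = i , ≤-trans i≤k k≤l , p

  compatible-iterʳ : ∀ {f g : RFun X ℓ} → Monotone g → Compatible f g → ∀ k → Compatible f (iter g k)
  compatible-iterʳ monoG cmp zero    S p = p
  compatible-iterʳ {g = g} monoG cmp (suc k) S p =
    monoG (compatible-iterʳ monoG cmp k S) (cmp (iter g k S) p)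

  compatible-iterˡ : ∀ {f g : RFun X ℓ} → Monotone f → Compatible f g → ∀ n → Compatible (iter f n) g
  compatible-iterˡ monoF cmp zero    S p = p
  compatible-iterˡ {f} monoF cmp (suc n) S p =
    cmp (iter f n S) (monoF (compatible-iterˡ monoF cmp n S) p)

  module PostFixpoint {f g : RFun X ℓ} (monoF : Monotone f) (monoG : Monotone g)
                      (cmp : Compatible f g) {R : Rel X ℓ} (R⇒gfR : R ⇒ g (f R)) where

    iter-postfix : ∀ i → iter f i R ⇒ g (iter f (suc i) R)
    iter-postfix zero    p = R⇒gfR p
    iter-postfix (suc i) p = cmp _ (monoF (iter-postfix i) p)

    iter-postfixᵏ : ∀ k i → iter f i R ⇒ iter g k (iter f (k + i) R)
    iter-postfixᵏ zero    i p = p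
    iter-postfixᵏ (suc k) i {x} {y} p =
      subst (λ j → g (iter g k (iter f j R)) x y) (+-suc k i)
            (monoG (iter-postfixᵏ k (suc i)) (iter-postfix i p))

    iterUpTo-postfixᵏ : ∀ k l → iterUpTo f l R ⇒ iter g k (iterUpTo f (k + l) R)
    iterUpTo-postfixᵏ k l (i , i≤l , p) =
      iter-monotone monoG k (λ q → k + i , +-monoʳ-≤ k i≤l , q) (iter-postfixᵏ k i p)

  m+[m*n+1]≡m*[1+n]+1 : ∀ m n → m + (m * n + 1) ≡ m * suc n + 1
  m+[m*n+1]≡m*[1+n]+1 m n = trans (sym (+-assoc m (m * n) 1)) (cong (_+ 1) (sym (*-suc m n)))

  module Invariant {f g h : RFun X ℓ} (m : ℕ)
                   (monoF : Monotone f) (monoG : Monotone g) (monoH : Monotone h)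
                   (cmp : Compatible f g) (cmp₂ : Compatible₂ f (h ∘ᶠ iter g m) h)
                   {R : Rel X ℓ} (R⇒gfR : R ⇒ g (f R)) (R⇒hfR : R ⇒ h (f R)) where

    open PostFixpoint monoF monoG cmp R⇒gfR public

    U : ℕ → RFun X ℓ
    U n = iterUpTo f (m * n + 1)

    U-step : ∀ n → U n R ⇒ iter g m (U (suc n) R)
    U-step n p = iter-monotone monoG m
      (iterUpTo-monotone (≤-reflexive (m+[m*n+1]≡m*[1+n]+1 m n)) R)
      (iterUpTo-postfixᵏ m (m * n + 1) p)

    U-mono : ∀ n → U n R ⇒ U (suc n) R
    U-mono n = iterUpTo-monotone
      (≤-trans (m≤n+m (m * n + 1) m) (≤-reflexive (m+[m*n+1]≡m*[1+n]+1 m n))) R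

    iter-h-invariant : ∀ n → iter f n R ⇒ h (iter f n (U n R))
    iter-h-invariant zero p = monoH (λ q → 1 , m≤n+m 1 (m * 0) , q) (R⇒hfR p)
    iter-h-invariant (suc n) p = cmp₂ _ (monoF (λ q → via-gᵐ q , via-U-mono q) p)
      where
      via-gᵐ : iter f n R ⇒ h (iter g m (iter f n (U (suc n) R)))
      via-gᵐ q = monoH
        (λ r → compatible-iterˡ monoF (compatible-iterʳ monoG cmp m) n _
                 (iter-monotone monoF n (U-step n) r))
        (iter-h-invariant n q)

      via-U-mono : iter f n R ⇒ h (iter f n (U (suc n) R))
      via-U-mono q = monoH (iter-monotone monoF n (U-mono n)) (iter-h-invariant n q)

theorem40 : ∀ {a ℓ : Level} {X : Set a} (f g h : RFun X ℓ) (m : ℕ) →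
    m ≥ 1 →
    Monotone f → Monotone g → Monotone h →
    g ⊆ᶠ idᶠ →
    Compatible f g →
    Compatible₂ f (h ∘ᶠ iter g m) h →
    (∀ (n : ℕ) → (iter f n ∘ᶠ iterUpTo f (m * n + 1)) ⊆ᶠ omega f) →
    SoundVia f (g ∩ᶠ h) (omega f)
theorem40 f g h m _ monoF monoG monoH _ cmp cmp₂ upTo⊆omega = omega-extensive , omega-postfix
  where
  omega-extensive : Extensive (omega f)
  omega-extensive R p = 0 , p

  omega-postfix : ∀ R → R ⇒ (g ∩ᶠ h) (f R) → omega f R ⇒ (g ∩ᶠ h) (omega f R)
  omega-postfix R R⇒ghfR (n , p) =
      monoG (λ q → suc n , q) (iter-postfix n p)
    , monoH (upTo⊆omega n R) (iter-h-invariant n p)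
    where
    open Invariant m monoF monoG monoH cmp cmp₂ (λ r → proj₁ (R⇒ghfR r)) (λ r → proj₂ (R⇒ghfR r))
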